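{- Let $S_2$ be the circle in the Euclidean plane circumscribed about an equilateral triangle with all sides of length $1$. Let $G$ be a connected graph having a (possibly degenerate) planar unit distance representation that places every vertex of $G$ at a point of $S_2$. Then $\chi(G) \leq 3$.
   Context: A (possibly degenerate) unit distance representation of a graph $G$ in $\mathbb{R}^k$ is a map $\rho: V(G) \to \mathbb{R}^k$, not necessarily injective, such that for every edge $uv$ the points $\rho(u)$ and $\rho(v)$ are at Euclidean distance exactly $1$. Planar means $k=2$. $\chi(G)$ is the chromatic number of $G$. -}

module Defs where

open import Level using (0ℓ)
open import Data.Nat using (ℕ)
open import Data.Fin using (Fin)
open import Data.Product using (_×_; _,_; Σ; ∃)
open import Data.Empty using (⊥)
open import Relation.Nullary using (¬_)
open import Relation.Binary.PropositionalEquality using (_≡_)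
open import Relation.Binary.Definitions using (Trichotomous; Transitive)
open import Relation.Binary.Construct.Closure.ReflexiveTransitive using (Star)
import Algebra.Structures as AS

-- The real numbers, given axiomatically as a Dedekind-complete ordered
-- field (unique up to isomorphism).

record RealField : Set₁ where
  infixl 6 _+_ _-_
  infixl 7 _*_
  infix 4 _<_ _≤_
  field
    Carrier : Set
    _+_ _*_ : Carrier → Carrier → Carrier
    -_      : Carrier → Carrier
    0# 1#   : Carrier
    _<_     : Carrier → Carrier → Set
    isCommutativeRing : AS.IsCommutativeRing {A = Carrier} _≡_ _+_ _*_ -_ 0# 1#
    0≢1     : ¬ (0# ≡ 1#)
    inverse : ∀ x → ¬ (x ≡ 0#) → Σ Carrier (λ y → x * y ≡ 1#)
    <-trans : Transitive _<_
    <-tri   : Trichotomous _≡_ _<_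
    +-mono-< : ∀ {x y} z → x < y → x + z < y + z
    *-pos    : ∀ {x y} → 0# < x → 0# < y → 0# < x * y
  _-_ : Carrier → Carrier → Carrier
  x - y = x + (- y)
  _≤_ : Carrier → Carrier → Set
  x ≤ y = ¬ (y < x)
  field
    complete : (P : Carrier → Set) → ∃ P → ∃ (λ b → ∀ x → P x → x ≤ b) →
               ∃ (λ s → (∀ x → P x → x ≤ s) ×
                        (∀ b → (∀ x → P x → x ≤ b) → s ≤ b))

module Plane (ℝ : RealField) where
  open RealField ℝ

  Point : Set
  Point = Carrier × Carrier

  dist² : Point → Point → Carrier
  dist² (x₁ , y₁) (x₂ , y₂) = (x₁ - x₂) * (x₁ - x₂) + (y₁ - y₂) * (y₁ - y₂)

  -- Euclidean distance is exactly 1  (equivalently: squared distance is 1,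
  -- since distances are nonnegative)
  UnitDist : Point → Point → Set
  UnitDist p q = dist² p q ≡ 1#

  UnitEquilateral : Point → Point → Point → Set
  UnitEquilateral A B C = UnitDist A B × UnitDist B C × UnitDist C A

  Circumcenter : Point → Point → Point → Point → Set
  Circumcenter A B C O = dist² O A ≡ dist² O B × dist² O B ≡ dist² O C

  OnCircumcircle : Point → Point → Point → Point → Point → Set
  OnCircumcircle A B C O P = Circumcenter A B C O × dist² O P ≡ dist² O A

record Graph : Set₁ where
  field
    n     : ℕ
    Adj   : Fin n → Fin n → Set
    sym   : ∀ {u v} → Adj u v → Adj v u
    irrefl : ∀ {u} → ¬ Adj u u

open Graph public

Connected : Graph → Set
Connected G = ∀ (u v : Fin (n G)) → Star (Adj G) u v

ProperColouring : (G : Graph) → (k : ℕ) → (Fin (n G) → Fin k) → Set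
ProperColouring G k c = ∀ {u v} → Adj G u v → ¬ (c u ≡ c v)

χ≤ : Graph → ℕ → Set
χ≤ G k = ∃ (ProperColouring G k)

UnitDistRep : (ℝ : RealField) → (G : Graph) → (Fin (n G) → Plane.Point ℝ) → Set
UnitDistRep ℝ G ρ = ∀ {u v} → Adj G u v → Plane.UnitDist ℝ (ρ u) (ρ v)

module Submission where

-- Identify the plane with ℂ = ℝ × ℝ and view every point P through its
-- position x = O - P relative to the circumcentre O.  With s = |x|² the
-- squared circumradius, two points x, y of the circle at distance 1 satisfy
-- conj x · y + conj y · x = 2 s - 1 (a unit chord).
--   * Three vectors of the plane have a singular Gram matrix; for A, B, C
--     this determinant is 2 (3 s - 1), hence 3 s = 1.
--   * Then t = conj x · y solves t² + s t + s² = 0, so x² + x y + y² = 0 and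
--     ω = 3 conj(O - A)(O - B) satisfies ω² + ω + 1 = 0.  Consequently
--     (y - ω x)(y - ω² x) = 0: along every edge of G the position is
--     multiplied by ω or by ω².
--   * A connected graph whose edges move a label by r or r² for a map r of
--     order 3 is 3-colourable by the exponent of r (orbit-colouring).

open import Defs hiding (sym)
open import Level using (0ℓ)
open import Data.Nat as ℕ using (ℕ; zero; suc)
open import Data.Fin using (Fin; zero; suc)
open import Data.Product using (_×_; _,_; Σ; proj₁; proj₂)
open import Data.Product.Properties using (≡-dec)
open import Data.Sum using (_⊎_; inj₁; inj₂)
import Data.Sum
open import Data.Maybe using (just; nothing)
open import Data.Empty using (⊥-elim)
open import Relation.Nullary using (¬_; yes; no)
open import Relation.Binary.PropositionalEquality
  using (_≡_; _≢_; refl; sym; trans; cong; cong₂; subst; subst₂; isEquivalence; module ≡-Reasoning)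
open import Relation.Binary.Definitions using (DecidableEquality; WeaklyDecidable; tri<; tri≈; tri>)
open import Relation.Binary.Construct.Closure.ReflexiveTransitive using (Star; ε; _◅_)
open import Algebra.Bundles using (CommutativeRing; RawRing)
open import Algebra.Structures using (IsCommutativeRing)
import Algebra.Solver.Ring
open import Algebra.Solver.Ring.AlmostCommutativeRing
  using (fromCommutativeRing; _-Raw-AlmostCommutative⟶_)

-- The ring solver for an arbitrary commutative ring R, with integer
-- coefficients coded as pairs (m , n) standing for m - n.  The solver
-- compares evaluated normal forms by `refl`, so the evaluation ⟦_⟧ is defined
-- to reduce every closed pair to ι k or - ι k, with ι 0 = 0# and ι 1 = 1#.
module DifferenceSolver {c ℓ} (R : CommutativeRing c ℓ) where
  open CommutativeRing R hiding (refl; sym; trans)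
  private module ≈ = CommutativeRing R using (refl; sym; trans)
  open import Algebra.Properties.Ring ring using (-0#≈0#; x[y-z]≈xy-xz; [y-z]x≈yx-zx)
  open import Algebra.Properties.AbelianGroup +-abelianGroup using (⁻¹-∙-comm; ⁻¹-anti-homo‿-)
  open import Algebra.Properties.CommutativeSemigroup +-commutativeSemigroup using (interchange)
  open import Algebra.Properties.Semiring.Mult.TCOptimised semiring
    using (×-homo-+; ×1-homo-*; 1+×) renaming (_×_ to _·_)
  open import Relation.Binary.Reasoning.Setoid setoid

  ι : ℕ → Carrier
  ι n = n · 1#

  ι-+ : ∀ m n → ι (m ℕ.+ n) ≈ ι m + ι n
  ι-+ = ×-homo-+ 1#

  ι-* : ∀ m n → ι (m ℕ.* n) ≈ ι m * ι n
  ι-* = ×1-homo-*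

  sub-+-interchange : ∀ x u y v → (x + u) - (y + v) ≈ (x - y) + (u - v)
  sub-+-interchange x u y v = begin
    (x + u) - (y + v)      ≈⟨ +-congˡ (⁻¹-∙-comm y v) ⟨
    (x + u) + (- y + - v)  ≈⟨ interchange x u (- y) (- v) ⟩
    (x - y) + (u - v)      ∎

  sub-cancelˡ : ∀ z x y → (z + x) - (z + y) ≈ x - y
  sub-cancelˡ z x y = begin
    (z + x) - (z + y)   ≈⟨ sub-+-interchange z x z y ⟩
    (z - z) + (x - y)   ≈⟨ +-congʳ (-‿inverseʳ z) ⟩
    0# + (x - y)        ≈⟨ +-identityˡ (x - y) ⟩
    x - y               ∎

  sub-*-expand : ∀ x y u v → (x - y) * (u - v) ≈ (x * u + y * v) - (x * v + y * u)
  sub-*-expand x y u v = begin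
    (x - y) * (u - v)                     ≈⟨ [y-z]x≈yx-zx (u - v) x y ⟩
    x * (u - v) - y * (u - v)             ≈⟨ +-cong (x[y-z]≈xy-xz x u v) (-‿cong (x[y-z]≈xy-xz y u v)) ⟩
    (x * u - x * v) - (y * u - y * v)     ≈⟨ +-congˡ (⁻¹-anti-homo‿- (y * u) (y * v)) ⟩
    (x * u - x * v) + (y * v - y * u)     ≈⟨ interchange (x * u) (- (x * v)) (y * v) (- (y * u)) ⟩
    (x * u + y * v) + (- (x * v) - y * u) ≈⟨ +-congˡ (⁻¹-∙-comm (x * v) (y * u)) ⟩
    (x * u + y * v) - (x * v + y * u)     ∎

  differences : RawRing 0ℓ 0ℓ
  differences = record
    { Carrier = ℕ × ℕ
    ; _≈_     = _≡_
    ; _+_     = λ { (a , b) (c , d) → (a ℕ.+ c , b ℕ.+ d) }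
    ; _*_     = λ { (a , b) (c , d) → (a ℕ.* c ℕ.+ b ℕ.* d , a ℕ.* d ℕ.+ b ℕ.* c) }
    ; -_      = λ { (a , b) → (b , a) }
    ; 0#      = (0 , 0)
    ; 1#      = (1 , 0)
    }
  private module D = RawRing differences

  ⟦_⟧ : ℕ × ℕ → Carrier
  ⟦ m , zero ⟧      = ι m
  ⟦ zero , suc n ⟧  = - ι (suc n)
  ⟦ suc m , suc n ⟧ = ⟦ m , n ⟧

  ⟦⟧-difference : ∀ m n → ⟦ m , n ⟧ ≈ ι m - ι n
  ⟦⟧-difference m       zero    = ≈.sym (≈.trans (+-congˡ -0#≈0#) (+-identityʳ (ι m)))
  ⟦⟧-difference zero    (suc n) = ≈.sym (+-identityˡ (- ι (suc n)))
  ⟦⟧-difference (suc m) (suc n) = begin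
    ⟦ m , n ⟧                 ≈⟨ ⟦⟧-difference m n ⟩
    ι m - ι n                 ≈⟨ sub-cancelˡ 1# (ι m) (ι n) ⟨
    (1# + ι m) - (1# + ι n)   ≈⟨ +-cong (1+× m 1#) (-‿cong (1+× n 1#)) ⟨
    ι (suc m) - ι (suc n)     ∎

  +-homo : ∀ p q → ⟦ p D.+ q ⟧ ≈ ⟦ p ⟧ + ⟦ q ⟧
  +-homo (a , b) (c , d) = begin
    ⟦ a ℕ.+ c , b ℕ.+ d ⟧       ≈⟨ ⟦⟧-difference (a ℕ.+ c) (b ℕ.+ d) ⟩
    ι (a ℕ.+ c) - ι (b ℕ.+ d)   ≈⟨ +-cong (ι-+ a c) (-‿cong (ι-+ b d)) ⟩
    (ι a + ι c) - (ι b + ι d)   ≈⟨ sub-+-interchange (ι a) (ι c) (ι b) (ι d) ⟩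
    (ι a - ι b) + (ι c - ι d)   ≈⟨ +-cong (⟦⟧-difference a b) (⟦⟧-difference c d) ⟨
    ⟦ a , b ⟧ + ⟦ c , d ⟧       ∎

  *-homo : ∀ p q → ⟦ p D.* q ⟧ ≈ ⟦ p ⟧ * ⟦ q ⟧
  *-homo (a , b) (c , d) = begin
    ⟦ a ℕ.* c ℕ.+ b ℕ.* d , a ℕ.* d ℕ.+ b ℕ.* c ⟧
      ≈⟨ ⟦⟧-difference (a ℕ.* c ℕ.+ b ℕ.* d) (a ℕ.* d ℕ.+ b ℕ.* c) ⟩
    ι (a ℕ.* c ℕ.+ b ℕ.* d) - ι (a ℕ.* d ℕ.+ b ℕ.* c)
      ≈⟨ +-cong (ι-sum-of-products a c b d) (-‿cong (ι-sum-of-products a d b c)) ⟩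
    (ι a * ι c + ι b * ι d) - (ι a * ι d + ι b * ι c)
      ≈⟨ sub-*-expand (ι a) (ι b) (ι c) (ι d) ⟨
    (ι a - ι b) * (ι c - ι d)
      ≈⟨ *-cong (⟦⟧-difference a b) (⟦⟧-difference c d) ⟨
    ⟦ a , b ⟧ * ⟦ c , d ⟧ ∎
    where
    ι-sum-of-products : ∀ k l m n → ι (k ℕ.* l ℕ.+ m ℕ.* n) ≈ ι k * ι l + ι m * ι n
    ι-sum-of-products k l m n = ≈.trans (ι-+ (k ℕ.* l) (m ℕ.* n)) (+-cong (ι-* k l) (ι-* m n))

  -‿homo : ∀ p → ⟦ D.- p ⟧ ≈ - ⟦ p ⟧
  -‿homo (a , b) = begin
    ⟦ b , a ⟧       ≈⟨ ⟦⟧-difference b a ⟩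
    ι b - ι a       ≈⟨ ⁻¹-anti-homo‿- (ι a) (ι b) ⟨
    - (ι a - ι b)   ≈⟨ -‿cong (⟦⟧-difference a b) ⟨
    - ⟦ a , b ⟧     ∎

  homomorphism : differences -Raw-AlmostCommutative⟶ fromCommutativeRing R
  homomorphism = record
    { ⟦_⟧ = ⟦_⟧ ; +-homo = +-homo ; *-homo = *-homo ; -‿homo = -‿homo
    ; 0-homo = ≈.refl ; 1-homo = ≈.refl }

  -- cancelling the common part of a pair does not change its value, so
  -- comparing reduced pairs decides equality of coefficients completely
  reduce : ℕ × ℕ → ℕ × ℕ
  reduce (suc m , suc n) = reduce (m , n)
  reduce p               = p

  ⟦⟧-reduce : ∀ p → ⟦ reduce p ⟧ ≡ ⟦ p ⟧
  ⟦⟧-reduce (suc m , suc n) = ⟦⟧-reduce (m , n)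
  ⟦⟧-reduce (zero , _)      = refl
  ⟦⟧-reduce (suc _ , zero)  = refl

  coefficient-equality : WeaklyDecidable (λ p q → ⟦ p ⟧ ≈ ⟦ q ⟧)
  coefficient-equality p q with ≡-dec ℕ._≟_ ℕ._≟_ (reduce p) (reduce q)
  ... | yes same = just (reflexive (trans (sym (⟦⟧-reduce p)) (trans (cong ⟦_⟧ same) (⟦⟧-reduce q))))
  ... | no _     = nothing

  open Algebra.Solver.Ring differences (fromCommutativeRing R) homomorphism coefficient-equality public
    using (Polynomial; solve; _:=_; _:+_; _:*_; _:-_; :-_; con)

-- A connected graph whose edges move a label x to r x or r (r x), for a map
-- r with r³ = id, is 3-colourable as soon as adjacent labels differ: every
-- label lies in the orbit {p, r p, r² p} of the label p of a fixed vertex,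
-- and the exponent of r is a proper colouring.
module OrbitColouring {X : Set} (r : X → X) (r³≡id : ∀ x → r (r (r x)) ≡ x) where

  orbit : X → Fin 3 → X
  orbit p zero             = p
  orbit p (suc zero)       = r p
  orbit p (suc (suc zero)) = r (r p)

  next : Fin 3 → Fin 3
  next zero             = suc zero
  next (suc zero)       = suc (suc zero)
  next (suc (suc zero)) = zero

  orbit-next : ∀ p i → orbit p (next i) ≡ r (orbit p i)
  orbit-next p zero             = refl
  orbit-next p (suc zero)       = refl
  orbit-next p (suc (suc zero)) = sym (r³≡id p)

  InOrbit : X → X → Set
  InOrbit p x = Σ (Fin 3) (λ i → orbit p i ≡ x)

  orbit-step : ∀ {p x y} → InOrbit p x → y ≡ r x ⊎ y ≡ r (r x) → InOrbit p y
  orbit-step {p} (i , refl) (inj₁ refl) = next i , orbit-next p i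
  orbit-step {p} (i , refl) (inj₂ refl) =
    next (next i) , trans (orbit-next p (next i)) (cong r (orbit-next p i))

  -- the first vertex, chosen without a case split on the number of vertices
  root : ∀ {m} → Fin m → Fin m
  root zero    = zero
  root (suc _) = zero

  root-constant : ∀ {m} (u v : Fin m) → root u ≡ root v
  root-constant zero    zero    = refl
  root-constant zero    (suc _) = refl
  root-constant (suc _) zero    = refl
  root-constant (suc _) (suc _) = refl

  orbit-colouring : (G : Graph) → Connected G → (f : Fin (n G) → X) →
                    (∀ {u v} → Adj G u v → f v ≡ r (f u) ⊎ f v ≡ r (r (f u))) →
                    (∀ {u v} → Adj G u v → f u ≢ f v) →
                    χ≤ G 3
  orbit-colouring G connected f step distinct = colour , proper
    where
    walk : ∀ {p u v} → Star (Adj G) u v → InOrbit p (f u) → InOrbit p (f v)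
    walk ε             inside = inside
    walk (edge ◅ path) inside = walk path (orbit-step inside (step edge))

    placement : ∀ v → InOrbit (f (root v)) (f v)
    placement v = walk (connected (root v) v) (zero , refl)

    colour : Fin (n G) → Fin 3
    colour v = proj₁ (placement v)

    proper : ProperColouring G 3 colour
    proper {u} {v} edge same = distinct edge (begin
      f u                             ≡⟨ proj₂ (placement u) ⟨
      orbit (f (root u)) (colour u)   ≡⟨ cong₂ (λ w i → orbit (f w) i) (root-constant u v) same ⟩
      orbit (f (root v)) (colour v)   ≡⟨ proj₂ (placement v) ⟩
      f v                             ∎)
      where open ≡-Reasoning

module RealFacts (ℝ : RealField) where
  open RealField ℝ

  ℝ-ring : CommutativeRing 0ℓ 0ℓ
  ℝ-ring = record { isCommutativeRing = isCommutativeRing }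

  open CommutativeRing ℝ-ring using (+-comm; +-identityˡ; +-identityʳ; *-identityˡ; zeroˡ; -‿inverseʳ)
  open DifferenceSolver ℝ-ring using (solve; _:=_; _:*_; :-_)

  infix 4 _≟_
  _≟_ : DecidableEquality Carrier
  x ≟ y with <-tri x y
  ... | tri< _ x≢y _ = no x≢y
  ... | tri≈ _ x≡y _ = yes x≡y
  ... | tri> _ x≢y _ = no x≢y

  <-irrefl : ∀ {x} → ¬ (x < x)
  <-irrefl {x} x<x with <-tri x x
  ... | tri< _ x≢x _ = x≢x refl
  ... | tri≈ x≮x _ _ = x≮x x<x
  ... | tri> _ x≢x _ = x≢x refl

  pos⇒nonzero : ∀ {a} → 0# < a → a ≢ 0#
  pos⇒nonzero 0<a refl = <-irrefl 0<a

  neg-pos : ∀ {x} → x < 0# → 0# < - x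
  neg-pos {x} x<0 = subst₂ _<_ (-‿inverseʳ x) (+-identityˡ (- x)) (+-mono-< (- x) x<0)

  square-pos : ∀ {x} → x ≢ 0# → 0# < x * x
  square-pos {x} x≢0 with <-tri 0# x
  ... | tri< 0<x _ _ = *-pos 0<x 0<x
  ... | tri≈ _ 0≡x _ = ⊥-elim (x≢0 (sym 0≡x))
  ... | tri> _ _ x<0 = subst (0# <_) (neg-square x) (*-pos (neg-pos x<0) (neg-pos x<0))
    where
    neg-square : ∀ x → - x * - x ≡ x * x
    neg-square = solve 1 (λ x → (:- x) :* (:- x) := x :* x) refl

  square-nonneg : ∀ x → ¬ (x * x < 0#)
  square-nonneg x xx<0 with x ≟ 0#
  ... | yes refl = <-irrefl (subst (_< 0#) (zeroˡ 0#) xx<0)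
  ... | no x≢0   = <-irrefl (<-trans (square-pos x≢0) xx<0)

  0<1 : 0# < 1#
  0<1 = subst (0# <_) (*-identityˡ 1#) (square-pos (λ 1≡0 → 0≢1 (sym 1≡0)))

  pos+nonneg : ∀ {a b} → 0# < a → ¬ (b < 0#) → 0# < a + b
  pos+nonneg {a} {b} 0<a b≮0 with <-tri 0# b
  ... | tri< 0<b _ _  = <-trans 0<b (subst (_< a + b) (+-identityˡ b) (+-mono-< b 0<a))
  ... | tri≈ _ refl _ = subst (0# <_) (sym (+-identityʳ a)) 0<a
  ... | tri> _ _ b<0  = ⊥-elim (b≮0 b<0)

  two-nonzero : 1# + 1# ≢ 0#
  two-nonzero = pos⇒nonzero (pos+nonneg 0<1 (λ 1<0 → <-irrefl (<-trans 1<0 0<1)))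

  sum-of-squares-nonzero : ∀ x y → x ≢ 0# ⊎ y ≢ 0# → x * x + y * y ≢ 0#
  sum-of-squares-nonzero x y (inj₁ x≢0) =
    pos⇒nonzero (pos+nonneg (square-pos x≢0) (square-nonneg y))
  sum-of-squares-nonzero x y (inj₂ y≢0) =
    pos⇒nonzero (subst (0# <_) (+-comm (y * y) (x * x)) (pos+nonneg (square-pos y≢0) (square-nonneg x)))

module Complex (ℝ : RealField) where
  private
    module R  = RealField ℝ
    module RF = RealFacts ℝ
    module RR = CommutativeRing RF.ℝ-ring
    module RS = DifferenceSolver RF.ℝ-ring
  open RS using (_:=_; _:+_; _:*_; _:-_; :-_; con)

  ℂ : Set
  ℂ = R.Carrier × R.Carrier

  infixl 6 _+_ _-_
  infixl 7 _*_
  infix  8 -_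

  _+_ : ℂ → ℂ → ℂ
  (a , b) + (c , d) = (a R.+ c , b R.+ d)

  _*_ : ℂ → ℂ → ℂ
  (a , b) * (c , d) = (a R.* c R.- b R.* d , a R.* d R.+ b R.* c)

  -_ : ℂ → ℂ
  - (a , b) = (R.- a , R.- b)

  _-_ : ℂ → ℂ → ℂ
  x - y = x + - y

  0# 1# : ℂ
  0# = (R.0# , R.0#)
  1# = (R.1# , R.0#)

  ↑_ : R.Carrier → ℂ
  ↑ r = (r , R.0#)

  conj : ℂ → ℂ
  conj (a , b) = (a , R.- b)

  ‖_‖² : ℂ → R.Carrier
  ‖ (a , b) ‖² = a R.* a R.+ b R.* b

  ℂ-isCommutativeRing : IsCommutativeRing _≡_ _+_ _*_ -_ 0# 1#
  ℂ-isCommutativeRing = record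
    { isRing = record
      { +-isAbelianGroup = record
        { isGroup = record
          { isMonoid = record
            { isSemigroup = record
              { isMagma = record { isEquivalence = isEquivalence ; ∙-cong = cong₂ _+_ }
              ; assoc = λ { (a , b) (c , d) (e , f) → cong₂ _,_ (RR.+-assoc a c e) (RR.+-assoc b d f) } }
            ; identity = (λ { (a , b) → cong₂ _,_ (RR.+-identityˡ a) (RR.+-identityˡ b) })
                       , (λ { (a , b) → cong₂ _,_ (RR.+-identityʳ a) (RR.+-identityʳ b) }) }
          ; inverse = (λ { (a , b) → cong₂ _,_ (RR.-‿inverseˡ a) (RR.-‿inverseˡ b) })
                    , (λ { (a , b) → cong₂ _,_ (RR.-‿inverseʳ a) (RR.-‿inverseʳ b) })
          ; ⁻¹-cong = cong (-_) }
        ; comm = λ { (a , b) (c , d) → cong₂ _,_ (RR.+-comm a c) (RR.+-comm b d) } }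
      ; *-cong = cong₂ _*_
      ; *-assoc = *-assoc
      ; *-identity = *-identityˡ , λ x → trans (*-comm x 1#) (*-identityˡ x)
      ; distrib = distribˡ , λ x y z → trans (*-comm (y + z) x)
                                        (trans (distribˡ x y z) (cong₂ _+_ (*-comm x y) (*-comm x z)))
      }
    ; *-comm = *-comm
    }
    where
    *-assoc : ∀ x y z → (x * y) * z ≡ x * (y * z)
    *-assoc (a , b) (c , d) (e , f) = cong₂ _,_
      (RS.solve 6 (λ a b c d e f → (a :* c :- b :* d) :* e :- (a :* d :+ b :* c) :* f
                                  := a :* (c :* e :- d :* f) :- b :* (c :* f :+ d :* e)) refl a b c d e f)
      (RS.solve 6 (λ a b c d e f → (a :* c :- b :* d) :* f :+ (a :* d :+ b :* c) :* e
                                  := a :* (c :* f :+ d :* e) :+ b :* (c :* e :- d :* f)) refl a b c d e f)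
    *-comm : ∀ x y → x * y ≡ y * x
    *-comm (a , b) (c , d) = cong₂ _,_
      (RS.solve 4 (λ a b c d → a :* c :- b :* d := c :* a :- d :* b) refl a b c d)
      (RS.solve 4 (λ a b c d → a :* d :+ b :* c := c :* b :+ d :* a) refl a b c d)
    *-identityˡ : ∀ x → 1# * x ≡ x
    *-identityˡ (a , b) = cong₂ _,_
      (RS.solve 2 (λ a b → con (1 , 0) :* a :- con (0 , 0) :* b := a) refl a b)
      (RS.solve 2 (λ a b → con (1 , 0) :* b :+ con (0 , 0) :* a := b) refl a b)
    distribˡ : ∀ x y z → x * (y + z) ≡ x * y + x * z
    distribˡ (a , b) (c , d) (e , f) = cong₂ _,_
      (RS.solve 6 (λ a b c d e f → a :* (c :+ e) :- b :* (d :+ f)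
                                  := (a :* c :- b :* d) :+ (a :* e :- b :* f)) refl a b c d e f)
      (RS.solve 6 (λ a b c d e f → a :* (d :+ f) :+ b :* (c :+ e)
                                  := (a :* d :+ b :* c) :+ (a :* f :+ b :* e)) refl a b c d e f)

  ℂ-ring : CommutativeRing 0ℓ 0ℓ
  ℂ-ring = record { isCommutativeRing = ℂ-isCommutativeRing }

  open CommutativeRing ℂ-ring public using (*-assoc; *-identityˡ; +-identityˡ; zeroˡ; zeroʳ)

  infix 4 _≟_
  _≟_ : DecidableEquality ℂ
  _≟_ = ≡-dec RF._≟_ RF._≟_

  1≢0 : 1# ≢ 0#
  1≢0 1≡0 = R.0≢1 (sym (cong proj₁ 1≡0))

  2≢0 : 1# + 1# ≢ 0#
  2≢0 2≡0 = RF.two-nonzero (cong proj₁ 2≡0)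

  conj-mul-self : ∀ x → conj x * x ≡ ↑ ‖ x ‖²
  conj-mul-self (a , b) = cong₂ _,_
    (RS.solve 2 (λ a b → a :* a :- (:- b) :* b := a :* a :+ b :* b) refl a b)
    (RS.solve 2 (λ a b → a :* b :+ (:- b) :* a := con (0 , 0)) refl a b)

  conj-sub : ∀ x y → conj (x - y) ≡ conj x - conj y
  conj-sub (a , b) (c , d) = cong (a R.+ R.- c ,_)
    (RS.solve 2 (λ b d → :- (b :- d) := (:- b) :- (:- d)) refl b d)

  ↑-* : ∀ r t → ↑ r * ↑ t ≡ ↑ (r R.* t)
  ↑-* r t = cong₂ _,_
    (RS.solve 2 (λ r t → r :* t :- con (0 , 0) :* con (0 , 0) := r :* t) refl r t)
    (RS.solve 2 (λ r t → r :* con (0 , 0) :+ con (0 , 0) :* t := con (0 , 0)) refl r t)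

  ‖‖²-nonzero : ∀ {x} → x ≢ 0# → ‖ x ‖² ≢ R.0#
  ‖‖²-nonzero {a , b} x≢0 with a RF.≟ R.0# | b RF.≟ R.0#
  ... | yes refl | yes refl = ⊥-elim (x≢0 refl)
  ... | no a≢0   | _        = RF.sum-of-squares-nonzero a b (inj₁ a≢0)
  ... | yes _    | no b≢0   = RF.sum-of-squares-nonzero a b (inj₂ b≢0)

  inverse : ∀ {x} → x ≢ 0# → Σ ℂ (λ y → y * x ≡ 1#)
  inverse {x} x≢0 = ↑ r * conj x , (begin
    ↑ r * conj x * x      ≡⟨ *-assoc (↑ r) (conj x) x ⟩
    ↑ r * (conj x * x)    ≡⟨ cong (↑ r *_) (conj-mul-self x) ⟩
    ↑ r * ↑ ‖ x ‖²        ≡⟨ ↑-* r ‖ x ‖² ⟩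
    ↑ (r R.* ‖ x ‖²)      ≡⟨ cong ↑_ (trans (RR.*-comm r ‖ x ‖²) ‖x‖²r≡1) ⟩
    1#                    ∎)
    where
    open ≡-Reasoning
    r : R.Carrier
    r = proj₁ (R.inverse ‖ x ‖² (‖‖²-nonzero x≢0))
    ‖x‖²r≡1 : ‖ x ‖² R.* r ≡ R.1#
    ‖x‖²r≡1 = proj₂ (R.inverse ‖ x ‖² (‖‖²-nonzero x≢0))

  cancelˡ : ∀ {x y} → x ≢ 0# → x * y ≡ 0# → y ≡ 0#
  cancelˡ {x} {y} x≢0 xy≡0 = begin
    y             ≡⟨ *-identityˡ y ⟨
    1# * y        ≡⟨ cong (_* y) wx≡1 ⟨
    w * x * y     ≡⟨ *-assoc w x y ⟩
    w * (x * y)   ≡⟨ cong (w *_) xy≡0 ⟩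
    w * 0#        ≡⟨ zeroʳ w ⟩
    0#            ∎
    where
    open ≡-Reasoning
    w : ℂ
    w = proj₁ (inverse x≢0)
    wx≡1 : w * x ≡ 1#
    wx≡1 = proj₂ (inverse x≢0)

  nonzero-product : ∀ {x y} → x ≢ 0# → y ≢ 0# → x * y ≢ 0#
  nonzero-product x≢0 y≢0 xy≡0 = y≢0 (cancelˡ x≢0 xy≡0)

  no-zero-divisors : ∀ {x y} → x * y ≡ 0# → x ≡ 0# ⊎ y ≡ 0#
  no-zero-divisors {x} xy≡0 with x ≟ 0#
  ... | yes x≡0 = inj₁ x≡0
  ... | no x≢0  = inj₂ (cancelˡ x≢0 xy≡0)

-- Unit chords of a circle centred at the origin.  All statements are about
-- ℂ-valued quantities; ⟪ x , y ⟫ is twice the real inner product of x and y.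
module UnitChords (ℝ : RealField) where
  open Complex ℝ
  open DifferenceSolver ℂ-ring using (ι; Polynomial; solve; _:=_; _:+_; _:*_; _:-_; con)
  open ≡-Reasoning

  ⟪_,_⟫ : ℂ → ℂ → ℂ
  ⟪ x , y ⟫ = conj x * y + conj y * x

  OnCircle : ℂ → ℂ → Set
  OnCircle s x = conj x * x ≡ s

  -- x and y lie on the circle of squared radius s and are at distance 1
  UnitChord : ℂ → ℂ → ℂ → Set
  UnitChord s x y = OnCircle s x × OnCircle s y × ⟪ x , y ⟫ ≡ s + s - 1#

  PrimitiveCubeRoot : ℂ → Set
  PrimitiveCubeRoot ω = ω * ω + ω + 1# ≡ 0#

  det₃ : ℂ → ℂ → ℂ → ℂ → ℂ → ℂ → ℂ
  det₃ p q r u v w = p * (u * w - v * v) - q * (q * w - v * r) + r * (q * v - u * r)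

  private
    det₃ᴾ : ∀ {n} → Polynomial n → Polynomial n → Polynomial n →
            Polynomial n → Polynomial n → Polynomial n → Polynomial n
    det₃ᴾ p q r u v w = p :* (u :* w :- v :* v) :- q :* (q :* w :- v :* r) :+ r :* (q :* v :- u :* r)

  sub-zero : ∀ {x y} → x - y ≡ 0# → x ≡ y
  sub-zero {x} {y} x-y≡0 = begin
    x             ≡⟨ solve 2 (λ x y → x := (x :- y) :+ y) refl x y ⟩
    (x - y) + y   ≡⟨ cong (_+ y) x-y≡0 ⟩
    0# + y        ≡⟨ +-identityˡ y ⟩
    y             ∎

  polarisation : ∀ x y → ⟪ x , y ⟫ ≡ ↑ ‖ x ‖² + ↑ ‖ y ‖² - ↑ ‖ y - x ‖²
  polarisation x y = begin
    ⟪ x , y ⟫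
      ≡⟨ solve 4 (λ x y x' y' → x' :* y :+ y' :* x := x' :* x :+ y' :* y :- (y' :- x') :* (y :- x))
               refl x y (conj x) (conj y) ⟩
    conj x * x + conj y * y - (conj y - conj x) * (y - x)
      ≡⟨ cong (λ z → conj x * x + conj y * y - z * (y - x)) (conj-sub y x) ⟨
    conj x * x + conj y * y - conj (y - x) * (y - x)
      ≡⟨ cong₂ (λ a b → a + b - conj (y - x) * (y - x)) (conj-mul-self x) (conj-mul-self y) ⟩
    ↑ ‖ x ‖² + ↑ ‖ y ‖² - conj (y - x) * (y - x)
      ≡⟨ cong (λ c → ↑ ‖ x ‖² + ↑ ‖ y ‖² - c) (conj-mul-self (y - x)) ⟩
    ↑ ‖ x ‖² + ↑ ‖ y ‖² - ↑ ‖ y - x ‖² ∎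

  -- The entries
  -- conj x * y + conj y * x form a sum of two matrices of rank one, so the
  -- determinant vanishes identically, conj a, conj b, conj c being arbitrary.
  gram-singular : ∀ a b c →
    det₃ ⟪ a , a ⟫ ⟪ a , b ⟫ ⟪ c , a ⟫ ⟪ b , b ⟫ ⟪ b , c ⟫ ⟪ c , c ⟫ ≡ 0#
  gram-singular a b c = solve 6 (λ a b c a' b' c' →
    det₃ᴾ (g a a' a a') (g a a' b b') (g c c' a a') (g b b' b b') (g b b' c c') (g c c' c c')
      := con (0 , 0)) refl a b c (conj a) (conj b) (conj c)
    where
    g : ∀ {n} → Polynomial n → Polynomial n → Polynomial n → Polynomial n → Polynomial n
    g x x' y y' = x' :* y :+ y' :* x

  -- The circle through the vertices of a unit equilateral triangle has
  -- squared radius 1/3: its Gram determinant equals 2 (3 s - 1).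
  equilateral-radius : ∀ {s a b c} → UnitChord s a b → UnitChord s b c → UnitChord s c a →
                       ι 3 * s ≡ 1#
  equilateral-radius {s} {a} {b} {c} (a∘ , b∘ , ab) (_ , c∘ , bc) (_ , _ , ca) =
    sub-zero (cancelˡ 2≢0 (begin
      (1# + 1#) * (ι 3 * s - 1#)
        ≡⟨ solve 1 (λ s → con (2 , 0) :* (con (3 , 0) :* s :- con (1 , 0))
                          := det₃ᴾ (d s) (e s) (e s) (d s) (e s) (d s)) refl s ⟩
      det₃ (s + s) (s + s - 1#) (s + s - 1#) (s + s) (s + s - 1#) (s + s)
        ≡⟨ cong-det₃ (diagonal a∘) ab ca (diagonal b∘) bc (diagonal c∘) ⟨
      det₃ ⟪ a , a ⟫ ⟪ a , b ⟫ ⟪ c , a ⟫ ⟪ b , b ⟫ ⟪ b , c ⟫ ⟪ c , c ⟫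
        ≡⟨ gram-singular a b c ⟩
      0# ∎))
    where
    diagonal : ∀ {x} → OnCircle s x → ⟪ x , x ⟫ ≡ s + s
    diagonal x∘ = cong₂ _+_ x∘ x∘
    cong-det₃ : ∀ {p p′ q q′ r r′ u u′ v v′ w w′} →
                p ≡ p′ → q ≡ q′ → r ≡ r′ → u ≡ u′ → v ≡ v′ → w ≡ w′ →
                det₃ p q r u v w ≡ det₃ p′ q′ r′ u′ v′ w′
    cong-det₃ refl refl refl refl refl refl = refl
    d e : ∀ {n} → Polynomial n → Polynomial n
    d s = s :+ s
    e s = s :+ s :- con (1 , 0)

  radius-nonzero : ∀ {s} → ι 3 * s ≡ 1# → s ≢ 0#
  radius-nonzero third refl = 1≢0 (trans (sym third) (zeroʳ (ι 3)))

  -- On a circle of squared radius s = 1/3 the quotient t = conj x * y of the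
  -- endpoints of a unit chord solves t² + s t + s² = 0: with u = conj y * x
  -- one has t u = s², t + u = 2 s - 1 = - s.
  cube-relation : ∀ {s x y} → ι 3 * s ≡ 1# → UnitChord s x y →
                  let t = conj x * y in t * t + s * t + s * s ≡ 0#
  cube-relation {s} {x} {y} third (x∘ , y∘ , xy) = begin
    t * t + s * t + s * s
      ≡⟨ cong₂ (λ σ τ → t * t + σ * t + σ * τ) x∘ y∘ ⟨
    t * t + conj x * x * t + conj x * x * (conj y * y)
      ≡⟨ solve 4 (λ x y x' y' → let t = x' :* y in
                   t :* t :+ x' :* x :* t :+ x' :* x :* (y' :* y)
                   := t :* ((x' :* y :+ y' :* x) :+ x' :* x)) refl x y (conj x) (conj y) ⟩
    t * (⟪ x , y ⟫ + conj x * x)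
      ≡⟨ cong₂ (λ σ τ → t * (σ + τ)) xy x∘ ⟩
    t * (s + s - 1# + s)
      ≡⟨ solve 2 (λ t s → t :* (s :+ s :- con (1 , 0) :+ s) := t :* (con (3 , 0) :* s :- con (1 , 0))) refl t s ⟩
    t * (ι 3 * s - 1#)
      ≡⟨ cong (λ σ → t * (σ - 1#)) third ⟩
    t * (1# - 1#)
      ≡⟨ solve 1 (λ t → t :* (con (1 , 0) :- con (1 , 0)) := con (0 , 0)) refl t ⟩
    0# ∎
    where
    t : ℂ
    t = conj x * y

  -- Multiplying by conj x ≠ 0 twice turns x² + x y + y² into t² + s t + s².
  chord-equation : ∀ {s x y} → ι 3 * s ≡ 1# → UnitChord s x y → x * x + x * y + y * y ≡ 0#
  chord-equation {s} {x} {y} third chord@(x∘ , _ , _) =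
    cancelˡ (nonzero-product x̄≢0 x̄≢0) (begin
      conj x * conj x * (x * x + x * y + y * y)
        ≡⟨ solve 3 (λ x y x' → x' :* x' :* (x :* x :+ x :* y :+ y :* y)
                     := x' :* y :* (x' :* y) :+ x' :* x :* (x' :* y) :+ x' :* x :* (x' :* x))
                 refl x y (conj x) ⟩
      t * t + conj x * x * t + conj x * x * (conj x * x)
        ≡⟨ cong (λ σ → t * t + σ * t + σ * σ) x∘ ⟩
      t * t + s * t + s * s
        ≡⟨ cube-relation third chord ⟩
      0# ∎)
    where
    t : ℂ
    t = conj x * y
    x̄≢0 : conj x ≢ 0#
    x̄≢0 x̄≡0 = radius-nonzero third (begin
      s            ≡⟨ x∘ ⟨
      conj x * x   ≡⟨ cong (_* x) x̄≡0 ⟩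
      0# * x       ≡⟨ zeroˡ x ⟩
      0#           ∎)

  -- ω = 3 conj a * b = t / s for a unit chord (a , b)
  chord-cube-root : ∀ {s a b} → ι 3 * s ≡ 1# → UnitChord s a b →
                    PrimitiveCubeRoot (ι 3 * (conj a * b))
  chord-cube-root {s} {a} {b} third chord = begin
    ω * ω + ω + 1#
      ≡⟨ solve 2 (λ t s → let ω = con (3 , 0) :* t in
                   ω :* ω :+ ω :+ con (1 , 0)
                   := con (9 , 0) :* (t :* t :+ s :* t :+ s :* s)
                      :+ (con (1 , 0) :- con (3 , 0) :* s) :* (con (3 , 0) :* t :+ con (1 , 0) :+ con (3 , 0) :* s))
               refl t s ⟩
    ι 9 * (t * t + s * t + s * s) + (1# - ι 3 * s) * (ι 3 * t + 1# + ι 3 * s)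
      ≡⟨ cong₂ (λ σ τ → ι 9 * σ + (1# - τ) * (ι 3 * t + 1# + ι 3 * s)) (cube-relation third chord) third ⟩
    ι 9 * 0# + (1# - 1#) * (ι 3 * t + 1# + ι 3 * s)
      ≡⟨ solve 1 (λ z → con (9 , 0) :* con (0 , 0) :+ (con (1 , 0) :- con (1 , 0)) :* z := con (0 , 0)) refl _ ⟩
    0# ∎
    where
    t ω : ℂ
    t = conj a * b
    ω = ι 3 * t

  -- ω³ - 1 = (ω - 1)(ω² + ω + 1)
  cube-root-order : ∀ {ω} → PrimitiveCubeRoot ω → ∀ x → ω * (ω * (ω * x)) ≡ x
  cube-root-order {ω} root x = begin
    ω * (ω * (ω * x))
      ≡⟨ solve 2 (λ ω x → ω :* (ω :* (ω :* x))
                   := x :+ (ω :- con (1 , 0)) :* (ω :* ω :+ ω :+ con (1 , 0)) :* x) refl ω x ⟩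
    x + (ω - 1#) * (ω * ω + ω + 1#) * x
      ≡⟨ cong (λ σ → x + (ω - 1#) * σ * x) root ⟩
    x + (ω - 1#) * 0# * x
      ≡⟨ solve 2 (λ ω x → x :+ (ω :- con (1 , 0)) :* con (0 , 0) :* x := x) refl ω x ⟩
    x ∎

  -- (y - ω x)(y - ω² x) = x² + x y + y² when ω² + ω + 1 = 0, so the endpoints
  -- of a unit chord differ by a rotation through ω or ω².
  chord-rotation : ∀ {s ω x y} → PrimitiveCubeRoot ω → ι 3 * s ≡ 1# → UnitChord s x y →
                   y ≡ ω * x ⊎ y ≡ ω * (ω * x)
  chord-rotation {s} {ω} {x} {y} root third chord =
    Data.Sum.map sub-zero sub-zero (no-zero-divisors factorisation)
    where
    factorisation : (y - ω * x) * (y - ω * (ω * x)) ≡ 0#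
    factorisation = begin
      (y - ω * x) * (y - ω * (ω * x))
        ≡⟨ solve 3 (λ ω x y → (y :- ω :* x) :* (y :- ω :* (ω :* x))
                     := (x :* x :+ x :* y :+ y :* y)
                        :+ (ω :* ω :+ ω :+ con (1 , 0)) :* ((ω :- con (1 , 0)) :* (x :* x) :- x :* y)) refl ω x y ⟩
      (x * x + x * y + y * y) + (ω * ω + ω + 1#) * ((ω - 1#) * (x * x) - x * y)
        ≡⟨ cong₂ (λ σ τ → σ + τ * ((ω - 1#) * (x * x) - x * y)) (chord-equation third chord) root ⟩
      0# + 0# * ((ω - 1#) * (x * x) - x * y)
        ≡⟨ solve 1 (λ z → con (0 , 0) :+ con (0 , 0) :* z := con (0 , 0)) refl _ ⟩
      0# ∎

module PlanarChords (ℝ : RealField) where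
  open Plane ℝ using (dist²)
  open Complex ℝ
  open UnitChords ℝ using (UnitChord; ⟪_,_⟫; polarisation)
  open DifferenceSolver ℂ-ring using (solve; _:=_; _:-_)
  private
    module R  = RealField ℝ
    module RS = DifferenceSolver (RealFacts.ℝ-ring ℝ)
  open ≡-Reasoning

  points-unit-chord : ∀ {O P Q S} → dist² O P ≡ S → dist² O Q ≡ S → dist² P Q ≡ R.1# →
                      UnitChord (↑ S) (O - P) (O - Q)
  points-unit-chord {O} {P} {Q} {S} OP OQ PQ =
    trans (conj-mul-self (O - P)) (cong ↑_ OP) ,
    trans (conj-mul-self (O - Q)) (cong ↑_ OQ) ,
    (begin
      ⟪ O - P , O - Q ⟫
        ≡⟨ polarisation (O - P) (O - Q) ⟩
      ↑ dist² O P + ↑ dist² O Q - ↑ ‖ (O - Q) - (O - P) ‖²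
        ≡⟨ cong (λ z → ↑ dist² O P + ↑ dist² O Q - ↑ ‖ z ‖²)
                (solve 3 (λ O P Q → (O :- Q) :- (O :- P) := P :- Q) refl O P Q) ⟩
      ↑ dist² O P + ↑ dist² O Q - ↑ dist² P Q
        ≡⟨ cong₂ (λ a b → ↑ a + ↑ b - ↑ dist² P Q) OP OQ ⟩
      ↑ S + ↑ S - ↑ dist² P Q
        ≡⟨ cong (λ c → ↑ S + ↑ S - ↑ c) PQ ⟩
      ↑ S + ↑ S - 1# ∎)

  positions-differ : ∀ O {P Q} → dist² P Q ≡ R.1# → O - P ≢ O - Q
  positions-differ O {P} {Q} PQ same = R.0≢1 (begin
    R.0#        ≡⟨ dist²-self P ⟨
    dist² P P   ≡⟨ cong (dist² P) P≡Q ⟩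
    dist² P Q   ≡⟨ PQ ⟩
    R.1#        ∎)
    where
    dist²-self : ∀ P → dist² P P ≡ R.0#
    dist²-self (a , b) = RS.solve 2 (λ a b → (a RS.:- a) RS.:* (a RS.:- a) RS.:+ (b RS.:- b) RS.:* (b RS.:- b)
                                             RS.:= RS.con (0 , 0)) refl a b
    P≡Q : P ≡ Q
    P≡Q = begin
      P             ≡⟨ solve 2 (λ O P → P := O :- (O :- P)) refl O P ⟩
      O - (O - P)   ≡⟨ cong (λ X → O - X) same ⟩
      O - (O - Q)   ≡⟨ solve 2 (λ O Q → O :- (O :- Q) := Q) refl O Q ⟩
      Q             ∎

lemma2 : (ℝ : RealField) → (A B C O : Plane.Point ℝ) →
         Plane.UnitEquilateral ℝ A B C → Plane.Circumcenter ℝ A B C O →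
         (G : Graph) → Connected G →
         (ρ : Fin (n G) → Plane.Point ℝ) → UnitDistRep ℝ G ρ →
         (∀ v → Plane.OnCircumcircle ℝ A B C O (ρ v)) →
         χ≤ G 3
lemma2 ℝ A B C O (AB , BC , CA) (OA≡OB , OB≡OC) G connected ρ unit onCircle =
  orbit-colouring G connected (λ v → O - ρ v) neighbours (λ edge → positions-differ O (unit edge))
  where
  open Plane ℝ using (dist²)
  open Complex ℝ
  open UnitChords ℝ
  open PlanarChords ℝ
  open DifferenceSolver ℂ-ring using (ι)

  S : RealField.Carrier ℝ
  S = dist² O A
  OB : dist² O B ≡ S
  OB = sym OA≡OB
  OC : dist² O C ≡ S
  OC = sym (trans OA≡OB OB≡OC)

  ab : UnitChord (↑ S) (O - A) (O - B)
  ab = points-unit-chord refl OB AB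
  third : ι 3 * ↑ S ≡ 1#
  third = equilateral-radius ab (points-unit-chord OB OC BC) (points-unit-chord OC refl CA)

  ω : ℂ
  ω = ι 3 * (conj (O - A) * (O - B))
  ω-root : PrimitiveCubeRoot ω
  ω-root = chord-cube-root third ab

  open OrbitColouring (ω *_) (cube-root-order ω-root)

  neighbours : ∀ {u v} → Adj G u v → O - ρ v ≡ ω * (O - ρ u) ⊎ O - ρ v ≡ ω * (ω * (O - ρ u))
  neighbours {u} {v} edge =
    chord-rotation ω-root third (points-unit-chord (proj₂ (onCircle u)) (proj₂ (onCircle v)) (unit edge))
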